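{- Let $n,k$ be integers with $3\leq k\leq n-1$ and let $G$ be a graph on $n$ vertices which is the $(1,2)$-step competition graph $C_{1,2}(T)$ of some $k$-hypertournament $T$ on $n$ vertices. Then the complement $G^{c}$ of $G$ does not contain a $3$-cycle.
   Context: Given integers $n\geq k>1$, a $k$-hypertournament on $n$ vertices is a pair $T=(V,A)$ where $|V|=n$ and $A$ is a set of $k$-tuples of distinct vertices (arcs) such that for every $k$-subset $S$ of $V$, $A$ contains exactly one of the $k!$ $k$-tuples whose entries are the elements of $S$. A path in $T$ is a sequence $v_1a_1v_2a_2\cdots a_{t-1}v_t$ of distinct vertices $v_1,\dots,v_t$ ($t\geq1$) and distinct arcs $a_1,\dots,a_{t-1}$ such that $v_i$ precedes $v_{i+1}$ in $a_i$; its length $l(\cdot)$ is the number of arcs, and it is an $(x,y)$-path if $v_1=x$, $v_t=y$. $C_{1,2}(T)$ is the graph on $V(T)$ in which $xy$ is an edge if and only if there exist a vertex $z\neq x,y$, an $(x,z)$-path $P$ and a $(y,z)$-path $Q$ such that: $y\notin V(P)$, $x\notin V(Q)$; either ($l(P)\leq 1$ and $l(Q)\leq 2$) or ($l(Q)\leq 1$ and $l(P)\leq 2$); and $P$, $Q$ are arc-disjoint. $G^c$ is the graph on $V(G)$ whose edges are the non-adjacent pairs of $G$. -}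

module Defs where

open import Data.Nat using (ℕ; suc; _≤_; _<_)
open import Data.Fin using (Fin)
open import Data.Vec using (Vec; lookup)
open import Data.Vec.Membership.Propositional using (_∈_)
open import Data.Product using (Σ; ∃; _×_; _,_)
open import Data.Sum using (_⊎_)
open import Relation.Binary.PropositionalEquality using (_≡_; _≢_)
open import Relation.Nullary using (¬_)

Tuple : ℕ → ℕ → Set
Tuple n k = Vec (Fin n) k

Distinct : ∀ {A : Set} {m} → Vec A m → Set
Distinct {m = m} t = ∀ (i j : Fin m) → lookup t i ≡ lookup t j → i ≡ j

SameEntries : ∀ {n k} → Tuple n k → Tuple n k → Set
SameEntries {n} s t = ∀ (x : Fin n) → (x ∈ s → x ∈ t) × (x ∈ t → x ∈ s)

-- A k-hypertournament on vertex set Fin n: arc set A (a predicate on k-tuples)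
-- such that every arc has distinct entries, and for every k-subset S
-- (given by a tuple s of distinct vertices listing S) exactly one tuple whose
-- entries are the elements of S lies in A.
record Hypertournament (n k : ℕ) : Set₁ where
  field
    Arc          : Tuple n k → Set
    arc-distinct : ∀ a → Arc a → Distinct a
    exists-arc   : ∀ (s : Tuple n k) → Distinct s →
                   Σ (Tuple n k) λ a → Arc a × SameEntries s a
    unique-arc   : ∀ (s : Tuple n k) → Distinct s → ∀ a b →
                   Arc a → SameEntries s a → Arc b → SameEntries s b → a ≡ b

open Hypertournament public

Precedes : ∀ {n k} → Fin n → Fin n → Tuple n k → Set
Precedes {k = k} x y a =
  Σ (Fin k) λ i → Σ (Fin k) λ j → (Data.Fin._<_ i j) × (lookup a i ≡ x) × (lookup a j ≡ y)

record Path {n k} (T : Hypertournament n k) (l : ℕ) : Set where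
  field
    verts          : Vec (Fin n) (suc l)
    arcs           : Vec (Tuple n k) l
    verts-distinct : Distinct verts
    arcs-distinct  : Distinct arcs
    arcs-in-T      : ∀ i → Arc T (lookup arcs i)
    steps          : ∀ (i : Fin l) →
                     Precedes (lookup verts (Data.Fin.inject₁ i))
                              (lookup verts (Data.Fin.suc i))
                              (lookup arcs i)

open Path public

start : ∀ {n k} {T : Hypertournament n k} {l} → Path T l → Fin n
start P = lookup (verts P) Data.Fin.zero

end : ∀ {n k} {T : Hypertournament n k} {l} → Path T l → Fin n
end {l = l} P = lookup (verts P) (Data.Fin.fromℕ l)

ArcDisjoint : ∀ {n k} {T : Hypertournament n k} {l m} → Path T l → Path T m → Set
ArcDisjoint P Q = ∀ i j → lookup (arcs P) i ≢ lookup (arcs Q) j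

C12Edge : ∀ {n k} → Hypertournament n k → Fin n → Fin n → Set
C12Edge {n} T x y =
  Σ (Fin n) λ z → z ≢ x × z ≢ y ×
  Σ ℕ λ l → Σ ℕ λ m → Σ (Path T l) λ P → Σ (Path T m) λ Q →
    start P ≡ x × end P ≡ z × start Q ≡ y × end Q ≡ z ×
    ¬ (y ∈ verts P) × ¬ (x ∈ verts Q) ×
    ((l ≤ 1 × m ≤ 2) ⊎ (m ≤ 1 × l ≤ 2)) ×
    ArcDisjoint P Q

ComplementHasTriangle : ∀ {n} → (Fin n → Fin n → Set) → Set
ComplementHasTriangle {n} E =
  Σ (Fin n) λ u → Σ (Fin n) λ v → Σ (Fin n) λ w →
    u ≢ v × v ≢ w × u ≢ w ×
    ¬ E u v × ¬ E v w × ¬ E u w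

-- Let x be the first of the three vertices in an arc a through them, and y, z the other
-- two. Since k < n some vertex o lies outside a, and an arc b through o, y and z differs
-- from a. Whichever of y and z comes later in b is then reached in one step from x
-- (through a) and from the other one (through b), so x is adjacent in C_{1,2}(T) to y
-- or to z.
module Submission where

open import Defs
open import Data.Nat as ℕ using (ℕ; zero; suc; _≤_; _∸_; _≤′_; ≤′-refl; ≤′-step; s≤s; z≤n)
open import Data.Nat.Properties using (≤⇒≤′; <⇒≤; <⇒≱)
open import Data.Fin as Fin using (Fin; zero; suc; _≟_)
open import Data.Fin.Properties using (<-cmp; <-trans; <⇒≢; ¬∀⟶∃¬; injective⇒≤)
open import Data.Vec using (Vec; []; _∷_; lookup)
open import Data.Vec.Relation.Unary.Any as Any using (here; there)
open import Data.Vec.Relation.Unary.Any.Properties using (lookup-index)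
open import Data.Vec.Membership.Propositional using (_∈_; _∉_)
open import Data.Vec.Membership.Propositional.Properties using (∈-lookup)
import Data.Vec.Membership.DecPropositional as DecMembership
open import Data.Product using (∃; _×_; _,_; proj₁)
open import Data.Sum using (_⊎_; inj₁; inj₂; [_,_]′)
import Data.Sum as Sum
open import Data.Empty using (⊥; ⊥-elim)
open import Function using (_∘_; id)
open import Relation.Binary using (tri<; tri≈; tri>)
open import Relation.Binary.PropositionalEquality using (_≡_; _≢_; refl; sym; trans; cong; subst; ≢-sym)
open import Relation.Nullary using (¬_)

_⊆_ : ∀ {A : Set} {m k} → Vec A m → Vec A k → Set
v ⊆ t = ∀ {x} → x ∈ v → x ∈ t

module _ {A : Set} where

  ∈⇒lookup : ∀ {m} {x : A} {t : Vec A m} → x ∈ t → ∃ λ i → lookup t i ≡ x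
  ∈⇒lookup x∈t = Any.index x∈t , sym (lookup-index x∈t)

  lookup⇒∈ : ∀ {m} {x : A} {t : Vec A m} {i} → lookup t i ≡ x → x ∈ t
  lookup⇒∈ {t = t} {i} refl = ∈-lookup i t

  ∉-∷ : ∀ {m} {x y : A} {t : Vec A m} → x ≢ y → x ∉ t → x ∉ y ∷ t
  ∉-∷ x≢y _   (here x≡y)  = x≢y x≡y
  ∉-∷ _   x∉t (there x∈t) = x∉t x∈t

  distinct-∷ : ∀ {m} {x : A} {t : Vec A m} → x ∉ t → Distinct t → Distinct (x ∷ t)
  distinct-∷ _   _  zero    zero    _ = refl
  distinct-∷ x∉t _  zero    (suc _) e = ⊥-elim (x∉t (lookup⇒∈ (sym e)))
  distinct-∷ x∉t _  (suc _) zero    e = ⊥-elim (x∉t (lookup⇒∈ e))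
  distinct-∷ _   dt (suc i) (suc j) e = cong suc (dt i j e)

  distinct₁ : (x : A) → Distinct (x ∷ [])
  distinct₁ x = distinct-∷ (λ ()) (λ ())

  distinct₂ : {x y : A} → x ≢ y → Distinct (x ∷ y ∷ [])
  distinct₂ x≢y = distinct-∷ (∉-∷ x≢y (λ ())) (distinct₁ _)

  distinct₃ : {x y z : A} → x ≢ y → x ≢ z → y ≢ z → Distinct (x ∷ y ∷ z ∷ [])
  distinct₃ x≢y x≢z y≢z = distinct-∷ (∉-∷ x≢y (∉-∷ x≢z (λ ()))) (distinct₂ y≢z)

∃∉ : ∀ {m n} → m ℕ.< n → (t : Vec (Fin n) m) → ∃ λ o → o ∉ t
∃∉ {m} {n} m<n t = ¬∀⟶∃¬ n (_∈ t) (λ o → DecMembership._∈?_ _≟_ o t) not-all∈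
  where
  not-all∈ : ¬ (∀ o → o ∈ t)
  not-all∈ all∈ = <⇒≱ m<n (injective⇒≤ index-injective)
    where
    index-injective : ∀ {i j} → Any.index (all∈ i) ≡ Any.index (all∈ j) → i ≡ j
    index-injective {i} {j} e =
      trans (lookup-index (all∈ i)) (trans (cong (lookup t) e) (sym (lookup-index (all∈ j))))

extend-distinct : ∀ {n m k} → m ≤′ k → k ≤ n → (v : Vec (Fin n) m) → Distinct v →
                  ∃ λ (t : Vec (Fin n) k) → Distinct t × v ⊆ t
extend-distinct ≤′-refl _ v dv = v , dv , id
extend-distinct (≤′-step m≤′k) k<n v dv with extend-distinct m≤′k (<⇒≤ k<n) v dv
... | t , dt , v⊆t with ∃∉ k<n t
...   | o , o∉t = o ∷ t , distinct-∷ o∉t dt , there ∘ v⊆t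

module _ {n k : ℕ} where

  Leads : Fin n → Fin n → Fin n → Tuple n k → Set
  Leads x y z a = Precedes x y a × Precedes x z a

  precedes⇒∈ʳ : ∀ {x y} (a : Tuple n k) → Precedes x y a → y ∈ a
  precedes⇒∈ʳ a (_ , _ , _ , _ , ey) = lookup⇒∈ ey

  precedes⇒≢ : ∀ {x y} (a : Tuple n k) → Distinct a → Precedes x y a → x ≢ y
  precedes⇒≢ a da (i , j , i<j , ex , ey) refl = <⇒≢ i<j (da i j (trans ex (sym ey)))

  precedes-trans : ∀ {x y z} (a : Tuple n k) → Distinct a →
                   Precedes x y a → Precedes y z a → Precedes x z a
  precedes-trans a da (i , j , i<j , ex , ey) (j′ , l , j′<l , ey′ , ez) =
    i , l , <-trans (subst (i Fin.<_) (da j j′ (trans ey (sym ey′))) i<j) j′<l , ex , ez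

  precedes-total : ∀ {x y} (a : Tuple n k) → x ∈ a → y ∈ a → x ≢ y →
                   Precedes x y a ⊎ Precedes y x a
  precedes-total a x∈a y∈a x≢y with ∈⇒lookup x∈a | ∈⇒lookup y∈a
  ... | i , ex | j , ey with <-cmp i j
  ...   | tri< i<j _ _ = inj₁ (i , j , i<j , ex , ey)
  ...   | tri≈ _ i≡j _ = ⊥-elim (x≢y (trans (sym ex) (trans (cong (lookup a) i≡j) ey)))
  ...   | tri> _ _ j<i = inj₂ (j , i , j<i , ey , ex)

  some-leads : ∀ {x y z} (a : Tuple n k) → Distinct a → x ∈ a → y ∈ a → z ∈ a →
               x ≢ y → x ≢ z → y ≢ z →
               Leads x y z a ⊎ Leads y x z a ⊎ Leads z x y a
  some-leads a da x∈a y∈a z∈a x≢y x≢z y≢z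
    with precedes-total a x∈a y∈a x≢y | precedes-total a x∈a z∈a x≢z
  ... | inj₁ x<y | inj₁ x<z = inj₁ (x<y , x<z)
  ... | inj₁ x<y | inj₂ z<x = inj₂ (inj₂ (z<x , precedes-trans a da z<x x<y))
  ... | inj₂ y<x | inj₁ x<z = inj₂ (inj₁ (y<x , precedes-trans a da y<x x<z))
  ... | inj₂ y<x | inj₂ z<x with precedes-total a y∈a z∈a y≢z
  ...   | inj₁ y<z = inj₂ (inj₁ (y<x , y<z))
  ...   | inj₂ z<y = inj₂ (inj₂ (z<x , z<y))

module _ {n k : ℕ} (T : Hypertournament n k) where

  ∃arc⊇ : ∀ {m} → m ≤ k → k ≤ n → (v : Vec (Fin n) m) → Distinct v →
          ∃ λ a → Arc T a × v ⊆ a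
  ∃arc⊇ m≤k k≤n v dv with extend-distinct (≤⇒≤′ m≤k) k≤n v dv
  ... | s , ds , v⊆s with exists-arc T s ds
  ...   | a , a∈T , s≈a = a , a∈T , λ x∈v → proj₁ (s≈a _) (v⊆s x∈v)

  arc-path : ∀ {x z a} → Arc T a → x ≢ z → Precedes x z a → Path T 1
  arc-path {x} {z} {a} a∈T x≢z x<z = record
    { verts          = x ∷ z ∷ []
    ; arcs           = a ∷ []
    ; verts-distinct = distinct₂ x≢z
    ; arcs-distinct  = distinct₁ a
    ; arcs-in-T      = λ { zero → a∈T }
    ; steps          = λ { zero → x<z }
    }

  C12Edge-sym : ∀ {x y} → C12Edge T x y → C12Edge T y x
  C12Edge-sym (z , z≢x , z≢y , l , m , P , Q , sP , eP , sQ , eQ , y∉P , x∉Q , len , P#Q) =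
    z , z≢y , z≢x , m , l , Q , P , sQ , eQ , sP , eP , x∉Q , y∉P , Sum.swap len ,
    λ i j e → P#Q j i (sym e)

  C12Edge-from-arcs : ∀ {x y z a b} → Arc T a → Arc T b → a ≢ b → x ≢ y →
                      Precedes x z a → Precedes y z b → C12Edge T x y
  C12Edge-from-arcs {x} {y} {z} {a} {b} a∈T b∈T a≢b x≢y x<z y<z =
    _ , ≢-sym x≢z , ≢-sym y≢z , 1 , 1 , arc-path a∈T x≢z x<z , arc-path b∈T y≢z y<z ,
    refl , refl , refl , refl ,
    ∉-∷ (≢-sym x≢y) (∉-∷ y≢z (λ ())) , ∉-∷ x≢y (∉-∷ x≢z (λ ())) ,
    inj₁ (s≤s z≤n , s≤s z≤n) , λ { zero zero → a≢b }
    where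
    x≢z : x ≢ z
    x≢z = precedes⇒≢ a (arc-distinct T a a∈T) x<z
    y≢z : y ≢ z
    y≢z = precedes⇒≢ b (arc-distinct T b b∈T) y<z

  leader-adjacent : ∀ {x y z a} → 3 ≤ k → k ℕ.< n → Arc T a → Leads x y z a → y ≢ z →
                    C12Edge T x y ⊎ C12Edge T x z
  leader-adjacent {x} {y} {z} {a} 3≤k k<n a∈T (x<y , x<z) y≢z with ∃∉ k<n a
  ... | o , o∉a = adjacent (∃arc⊇ 3≤k (<⇒≤ k<n) (o ∷ y ∷ z ∷ []) (distinct₃ o≢y o≢z y≢z))
    where
    o≢y : o ≢ y
    o≢y refl = o∉a (precedes⇒∈ʳ a x<y)
    o≢z : o ≢ z
    o≢z refl = o∉a (precedes⇒∈ʳ a x<z)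
    adjacent : (∃ λ b → Arc T b × (o ∷ y ∷ z ∷ []) ⊆ b) → C12Edge T x y ⊎ C12Edge T x z
    adjacent (b , b∈T , oyz⊆b) =
      Sum.map (C12Edge-from-arcs a∈T b∈T a≢b x≢y x<z) (C12Edge-from-arcs a∈T b∈T a≢b x≢z x<y)
              (precedes-total b (oyz⊆b (there (here refl))) (oyz⊆b (there (there (here refl)))) y≢z)
      where
      a≢b : a ≢ b
      a≢b refl = o∉a (oyz⊆b (here refl))
      x≢y : x ≢ y
      x≢y = precedes⇒≢ a (arc-distinct T a a∈T) x<y
      x≢z : x ≢ z
      x≢z = precedes⇒≢ a (arc-distinct T a a∈T) x<z

lemma3p2 : (n k : ℕ) → 3 ≤ k → k ≤ n ∸ 1 →
    (T : Hypertournament n k) → ¬ ComplementHasTriangle (C12Edge T)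
lemma3p2 zero (suc (suc (suc _))) _ () _
lemma3p2 (suc n) k 3≤k k≤n T (u , v , w , u≢v , v≢w , u≢w , ¬uv , ¬vw , ¬uw) =
  refute (∃arc⊇ T 3≤k (<⇒≤ k<1+n) (u ∷ v ∷ w ∷ []) (distinct₃ u≢v u≢w v≢w))
  where
  k<1+n : k ℕ.< suc n
  k<1+n = s≤s k≤n
  adjacent : ∀ {x y z a} → Arc T a → Leads x y z a → y ≢ z → C12Edge T x y ⊎ C12Edge T x z
  adjacent = leader-adjacent T 3≤k k<1+n
  refute : (∃ λ a → Arc T a × (u ∷ v ∷ w ∷ []) ⊆ a) → ⊥
  refute (a , a∈T , uvw⊆a)
    with some-leads a (arc-distinct T a a∈T) (uvw⊆a (here refl)) (uvw⊆a (there (here refl)))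
                    (uvw⊆a (there (there (here refl)))) u≢v u≢w v≢w
  ... | inj₁ u-leads        = [ ¬uv , ¬uw ]′ (adjacent a∈T u-leads v≢w)
  ... | inj₂ (inj₁ v-leads) = [ ¬uv ∘ C12Edge-sym T , ¬vw ]′ (adjacent a∈T v-leads u≢w)
  ... | inj₂ (inj₂ w-leads) = [ ¬uw ∘ C12Edge-sym T , ¬vw ∘ C12Edge-sym T ]′ (adjacent a∈T w-leads u≢v)
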